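{- Let $\mathcal N,\mathcal N'$ be one-counter nets with control states $Q,Q'$, let $\preceq$ be the strong simulation preorder between them, and let $R\subseteq Q\times\mathbb N\times Q'\times\mathbb N$. If for every $(pm,p'm')\in R$ there exists $(n,n')\in\mathbb N^2$ with $NH^{(m,m')}_R=NH^{(n,n')}_{\preceq}$, then $R$ is a strong simulation.
   Context: OCN $(Q,\mathrm{Act},\delta)$ with $\delta\subseteq Q\times\mathrm{Act}\times\{ -1,0,1\}\times Q$ induces the LTS on $Q\times\mathbb N$ with $pm\xrightarrow{a}qn$ iff $(p,a,d,q)\in\delta$, $n=m+d\ge0$. A relation $R$ is a strong simulation if for $(c,c')\in R$ and $c\xrightarrow{a}d$ there is $c'\xrightarrow{a}d'$ with $(d,d')\in R$; $\preceq$ is the largest strong simulation. For $R\subseteq Q\times\mathbb N\times Q'\times\mathbb N$ and $(m,m')\in\mathbb N^2$, the $R$-neighborhood $NH^{(m,m')}_R: Q\times Q'\times\{ -1,0,1\}\times\{ -1,0,1\}\to\{0,1,\bot\}$ maps $(q,q',l,l')$ to $\bot$ if $m+l<0$ or $m'+l'<0$, to $1$ if $(q(m+l),q'(m'+l'))\in R$, and to $0$ otherwise. -}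

module Defs where

open import Level using (Level; _⊔_) renaming (suc to lsuc; zero to lzero)
open import Data.Nat using (ℕ; zero; suc)
open import Data.Fin using (Fin)
open import Data.Maybe using (Maybe; just; nothing)
open import Data.Product using (Σ; ∃; _×_; _,_)
open import Relation.Binary.PropositionalEquality using (_≡_)
open import Function.Bundles using (_⇔_)
open import Data.Sum using (_⊎_)

data Eff : Set where
  dec nop inc : Eff

_⊕_ : ℕ → Eff → Maybe ℕ
zero  ⊕ dec = nothing
suc m ⊕ dec = just m
m     ⊕ nop = just m
m     ⊕ inc = just (suc m)

record OCN (Act : Set) : Set₁ where
  field
    nQ : ℕ
    δ  : Fin nQ → Act → Eff → Fin nQ → Set

  State : Set
  State = Fin nQ

open OCN public

Step : {Act : Set} (N : OCN Act) → State N → ℕ → Act → State N → ℕ → Set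
Step N p m a q n = Σ Eff λ d → δ N p a d q × (m ⊕ d ≡ just n)

Rel : {Act : Set} → OCN Act → OCN Act → (ℓ : Level) → Set (lsuc ℓ)
Rel N N' ℓ = State N → ℕ → State N' → ℕ → Set ℓ

IsSimulation : {Act : Set} {ℓ : Level} (N N' : OCN Act) → Rel N N' ℓ → Set ℓ
IsSimulation N N' R =
  ∀ p m p' m' → R p m p' m' →
  ∀ a q n → Step N p m a q n →
  Σ (State N') λ q' → Σ ℕ λ n' → Step N' p' m' a q' n' × R q n q' n'

-- the simulation preorder: largest strong simulation (union of all simulations)
-- (quantifies over Set-valued relations, hence lives in Set₁)
_⊑_ : {Act : Set} (N N' : OCN Act) → Rel N N' (lsuc lzero)
(N ⊑ N') p m p' m' = Σ (Rel N N' lzero) λ S → IsSimulation N N' S × S p m p' m'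

-- Equality of neighbourhoods NH^{(m,m')}_R = NH^{(n,n')}_S, unfolded pointwise:
-- for every (q,q',l,l'), the value is ⊥ on one side iff it is ⊥ on the other
-- (⊥ means m+l<0 or m'+l'<0), and when both are defined the values 0/1 agree,
-- i.e. (q(m+l),q'(m'+l')) ∈ R iff (q(n+l),q'(n'+l')) ∈ S.
NHEq : {Act : Set} {ℓ ℓ' : Level} (N N' : OCN Act) →
       Rel N N' ℓ → ℕ → ℕ → Rel N N' ℓ' → ℕ → ℕ → Set (ℓ ⊔ ℓ')
NHEq N N' R m m' S n n' =
  ∀ (q : State N) (q' : State N') (l l' : Eff) →
    ((m ⊕ l ≡ nothing ⊎ m' ⊕ l' ≡ nothing) ⇔ (n ⊕ l ≡ nothing ⊎ n' ⊕ l' ≡ nothing))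
    × (∀ a a' b b' → m ⊕ l ≡ just a → m' ⊕ l' ≡ just a' →
         n ⊕ l ≡ just b → n' ⊕ l' ≡ just b' →
         (R q a q' a' ⇔ S q b q' b'))

-- Given (pm, p'm') ∈ R with neighbourhood equal to that of (pn, p'n') in ⊑, the entry at
-- offsets (0,0) puts (pn, p'n') in ⊑. A move of pm by effect d is still enabled at pn,
-- because both neighbourhoods have the same ⊥-pattern, so the simulation ⊑ answers it
-- with some p' -d'-> q'; reading the neighbourhoods backwards, m' + d' is defined too, and
-- the entry at (q, q', d, d') transports membership in ⊑ back to membership in R.
module Submission where

open import Defs
open import Data.Nat using (ℕ; zero; suc)
open import Agda.Primitive using (Level; lzero)
open import Data.Maybe using (Maybe; just; nothing)
open import Data.Product using (Σ; ∃; _,_; proj₁; proj₂)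
open import Data.Sum using (_⊎_; inj₁; inj₂)
open import Data.Empty using (⊥-elim)
open import Relation.Nullary using (¬_)
open import Relation.Binary.PropositionalEquality using (_≡_; _≢_; refl; sym; trans)
open import Function.Base using (_∘_)
open import Function.Bundles using (Equivalence)
open import Function.Properties.Equivalence as ⇔ using ()

just≢nothing : {A : Set} {x : A} → just x ≢ nothing
just≢nothing ()

≢nothing⇒just : {A : Set} (x : Maybe A) → x ≢ nothing → ∃ λ v → x ≡ just v
≢nothing⇒just (just v) _        = v , refl
≢nothing⇒just nothing  x≢nothing = ⊥-elim (x≢nothing refl)

⊕-nop : ∀ m → m ⊕ nop ≡ just m
⊕-nop zero    = refl
⊕-nop (suc m) = refl

⊑-isSimulation : {Act : Set} (N N' : OCN Act) → IsSimulation N N' (N ⊑ N')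
⊑-isSimulation N N' p m p' m' (S , S-sim , pm∼p'm') a q n pm→qn
  with S-sim p m p' m' pm∼p'm' a q n pm→qn
... | q' , n' , p'm'→q'n' , qn∼q'n' = q' , n' , p'm'→q'n' , S , S-sim , qn∼q'n'

module _ {Act : Set} {ℓ ℓ' : Level} (N N' : OCN Act)
         (R : Rel N N' ℓ) (m m' : ℕ) (S : Rel N N' ℓ') (n n' : ℕ) where

  NHEq-sym : NHEq N N' R m m' S n n' → NHEq N N' S n n' R m m'
  NHEq-sym nh q q' l l' =
    ⇔.sym (proj₁ (nh q q' l l')) ,
    λ a a' b b' n⊕l n'⊕l' m⊕l m'⊕l' → ⇔.sym (proj₂ (nh q q' l l') b b' a a' m⊕l m'⊕l' n⊕l n'⊕l')

  NHEq-centre : NHEq N N' R m m' S n n' → ∀ q q' → R q m q' m' → S q n q' n'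
  NHEq-centre nh q q' =
    Equivalence.to (proj₂ (nh q q' nop nop) m m' n n' (⊕-nop m) (⊕-nop m') (⊕-nop n) (⊕-nop n'))

  NHEq-defined : NHEq N N' R m m' S n n' → (q : State N) (q' : State N') (l l' : Eff) {a a' : ℕ} →
                 m ⊕ l ≡ just a → m' ⊕ l' ≡ just a' →
                 ¬ (n ⊕ l ≡ nothing ⊎ n' ⊕ l' ≡ nothing)
  NHEq-defined nh q q' l l' m⊕l m'⊕l' undefined
    with Equivalence.from (proj₁ (nh q q' l l')) undefined
  ... | inj₁ m⊕l≡nothing   = just≢nothing (trans (sym m⊕l) m⊕l≡nothing)
  ... | inj₂ m'⊕l'≡nothing = just≢nothing (trans (sym m'⊕l') m'⊕l'≡nothing)

lemma4p15 : {Act : Set} (N N' : OCN Act) (R : Rel N N' lzero) →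
    (∀ p m p' m' → R p m p' m' →
      Σ ℕ λ n → Σ ℕ λ n' → NHEq N N' R m m' (N ⊑ N') n n') →
    IsSimulation N N' R
lemma4p15 N N' R local p m p' m' pm∼p'm' a q n (d , t , m⊕d)
  with local p m p' m' pm∼p'm'
... | k , k' , nh
  with ≢nothing⇒just (k ⊕ d) (NHEq-defined N N' R m m' (N ⊑ N') k k' nh p p' d nop m⊕d (⊕-nop m') ∘ inj₁)
... | kd , k⊕d
  with ⊑-isSimulation N N' p k p' k' (NHEq-centre N N' R m m' (N ⊑ N') k k' nh p p' pm∼p'm')
         a q kd (d , t , k⊕d)
... | q' , kd' , (d' , t' , k'⊕d') , qkd⊑q'kd'
  with ≢nothing⇒just (m' ⊕ d')
         (NHEq-defined N N' (N ⊑ N') k k' R m m' (NHEq-sym N N' R m m' (N ⊑ N') k k' nh) q q' d d' k⊕d k'⊕d' ∘ inj₂)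
... | n' , m'⊕d' =
  q' , n' , (d' , t' , m'⊕d') ,
  Equivalence.from (proj₂ (nh q q' d d') n n' kd kd' m⊕d m'⊕d' k⊕d k'⊕d') qkd⊑q'kd'
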